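{- Let $K_{n,m}$ be the complete bipartite graph with parts of sizes $n,m\ge 1$. In the edge-distinguishing game (EDGe) played on $K_{n,m}$ (with $\lambda(K_{n,m})$ colors), Player 1 has a winning strategy if $n+m$ is odd, and Player 2 has a winning strategy if $n+m$ is even.
   Context: All graphs are finite and simple. For a positive integer $k$ let $[k]=\{1,\dots,k\}$. A $k$-coloring of a graph $G$ is a map $c:V(G)\to[k]$; it induces the edge coloring $c'(\{u,v\})=\{c(u),c(v)\}$, a 2-element multiset of colors. The coloring $c$ is edge-distinguishing if $c'$ is injective, and $\lambda(G)$ is the least $k$ for which an edge-distinguishing $k$-coloring of $G$ exists. A partial coloring is a map $c:U\to[k]$ with $U\subseteq V(G)$; its partial induced edge coloring is the induced edge coloring on $G[U]$. EDGe on $G$: two players, Player 1 moving first, alternately choose an uncolored vertex and give it a color from $[\lambda(G)]$; a move is legal iff afterwards the partial induced edge coloring of the colored vertices is injective. The player making the last legal move wins. A player has a winning strategy if they can guarantee a win regardless of the opponent's moves. -}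

module Defs where

open import Data.Nat using (ℕ; _<_; _≤_; _%_)
open import Data.Fin using (Fin)
import Data.Fin.Properties as FinP
open import Data.Sum using (_⊎_; inj₁; inj₂)
import Data.Sum.Properties as SumP
open import Data.Product using (_×_; Σ; ∃)
open import Data.Maybe using (Maybe; just; nothing)
open import Data.Unit using (⊤)
open import Data.Empty using (⊥)
open import Relation.Nullary using (¬_; yes; no)
open import Relation.Binary.Definitions using (DecidableEquality)
open import Relation.Binary.PropositionalEquality using (_≡_)

record Graph : Set₁ where
  field
    V      : Set
    _≟V_   : DecidableEquality V
    Adj    : V → V → Set
    symm   : ∀ {u v} → Adj u v → Adj v u
    irrefl : ∀ {u} → ¬ Adj u u

SameEdge : {V : Set} → V → V → V → V → Set
SameEdge u v x y = (u ≡ x × v ≡ y) ⊎ (u ≡ y × v ≡ x)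

-- Colors [k] are represented by Fin k.
-- c is edge-distinguishing: the induced multiset edge coloring is injective.
EdgeDistinguishing : (G : Graph) (k : ℕ) → (Graph.V G → Fin k) → Set
EdgeDistinguishing G k c =
  ∀ u v x y → Adj u v → Adj x y →
  SameEdge (c u) (c v) (c x) (c y) → SameEdge u v x y
  where open Graph G

IsLambda : Graph → ℕ → Set
IsLambda G k =
  (Σ (Graph.V G → Fin k) (EdgeDistinguishing G k)) ×
  (∀ j → j < k → ¬ Σ (Graph.V G → Fin j) (EdgeDistinguishing G j))

PartialColoring : Graph → ℕ → Set
PartialColoring G k = Graph.V G → Maybe (Fin k)

PartialInjective : (G : Graph) (k : ℕ) → PartialColoring G k → Set
PartialInjective G k c =
  ∀ u v x y (a b a' b' : Fin k) → Adj u v → Adj x y →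
  c u ≡ just a → c v ≡ just b → c x ≡ just a' → c y ≡ just b' →
  SameEdge a b a' b' → SameEdge u v x y
  where open Graph G

update : (G : Graph) (k : ℕ) → PartialColoring G k → Graph.V G → Fin k → PartialColoring G k
update G k c v a w with Graph._≟V_ G w v
... | yes _ = just a
... | no _  = c w

-- Win s: the player to move from position s has a
-- winning strategy; Lose s: the player to move from s loses against any play
-- of the opponent (the opponent has a winning strategy).
-- The last player to move wins (no legal move = loss for the player to move).
mutual
  data Win (G : Graph) (k : ℕ) (s : PartialColoring G k) : Set where
    win : (v : Graph.V G) (a : Fin k) → s v ≡ nothing →
          PartialInjective G k (update G k s v a) →
          Lose G k (update G k s v a) → Win G k s

  data Lose (G : Graph) (k : ℕ) (s : PartialColoring G k) : Set where
    lose : ((v : Graph.V G) (a : Fin k) → s v ≡ nothing →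
            PartialInjective G k (update G k s v a) →
            Win G k (update G k s v a)) → Lose G k s

emptyColoring : (G : Graph) (k : ℕ) → PartialColoring G k
emptyColoring G k _ = nothing

Player1Wins : (G : Graph) (k : ℕ) → Set
Player1Wins G k = Win G k (emptyColoring G k)

Player2Wins : (G : Graph) (k : ℕ) → Set
Player2Wins G k = Lose G k (emptyColoring G k)

KAdj : {n m : ℕ} → Fin n ⊎ Fin m → Fin n ⊎ Fin m → Set
KAdj (inj₁ _) (inj₁ _) = ⊥
KAdj (inj₁ _) (inj₂ _) = ⊤
KAdj (inj₂ _) (inj₁ _) = ⊤
KAdj (inj₂ _) (inj₂ _) = ⊥

KAdj-sym : {n m : ℕ} {u v : Fin n ⊎ Fin m} → KAdj u v → KAdj v u
KAdj-sym {u = inj₁ _} {inj₂ _} p = p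
KAdj-sym {u = inj₂ _} {inj₁ _} p = p

KAdj-irr : {n m : ℕ} {u : Fin n ⊎ Fin m} → ¬ KAdj u u
KAdj-irr {u = inj₁ _} ()
KAdj-irr {u = inj₂ _} ()

K : ℕ → ℕ → Graph
K n m = record
  { V = Fin n ⊎ Fin m
  ; _≟V_ = SumP.≡-dec FinP._≟_ FinP._≟_
  ; Adj = KAdj
  ; symm = KAdj-sym
  ; irrefl = KAdj-irr
  }

{-# OPTIONS --safe #-}
module Submission where

-- An edge-distinguishing coloring of K_{n,m} colors each part injectively and shares at most
-- one color between the parts, so λ(K_{n,m}) ≥ n + m − 1.  With that many colors, an
-- uncolored vertex v can always be colored legally as soon as both parts contain a colored
-- vertex: if some edge is monochromatic, counting shows that some color is not used at all.  From then on the
-- game only stops when every vertex is colored, so the parity of n + m decides the winner.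
-- Player 1 (n + m odd) opens in a part whose opposite part has even size: while the opposite
-- part stays uncolored, the opened part has an uncolored vertex whenever an odd number of
-- vertices is left.  Player 2 (n + m even) answers the opening by repeating its color on a
-- vertex of the other part.

open import Defs
open import Data.Nat using (ℕ; zero; suc; _≤_; _+_; _%_; z≤n; s≤s)
open import Data.Nat.Base using (parity)
open import Data.Nat.Properties using (0≢1+n; suc-injective; +-suc; <-irrefl; ≤-trans; _≟_)
open import Data.Parity.Base as ℙ using (Parity; 0ℙ; 1ℙ; _⁻¹)
open import Data.Parity.Properties using (suc-homo-⁻¹; +-homo-+; +-identityʳ)
open import Data.Fin using (Fin; zero; suc; join; splitAt)
open import Data.Fin.Properties using (any?; injective⇒≤; splitAt-join; join-splitAt)
import Data.Fin.Properties as Fin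
open import Data.Vec.Functional using (_∷_)
open import Data.Sum using (_⊎_; inj₁; inj₂)
open import Data.Sum.Properties using (inj₁-injective; inj₂-injective)
import Data.Sum.Properties as Sum
open import Data.Product using (_×_; _,_; proj₁; proj₂; ∃; ∃₂; map₂)
open import Data.Maybe using (Maybe; just; nothing; maybe′)
open import Data.Maybe.Properties using (just-injective)
import Data.Maybe.Properties as Maybe
open import Data.Empty using (⊥; ⊥-elim)
open import Data.Unit using (tt)
open import Function using (_∘_; _$_)
open import Function.Definitions using (Injective)
open import Relation.Nullary using (¬_; Dec; yes; no; contradiction; ¬?)
open import Relation.Nullary.Decidable using (_×-dec_; decidable-stable)
open import Relation.Unary using (Decidable)
open import Relation.Binary.PropositionalEquality

private
  variable
    A : Set
    a b c d e : A
    j k m n : ℕ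

SameEdge-sym : SameEdge a b c d → SameEdge c d a b
SameEdge-sym (inj₁ (refl , refl)) = inj₁ (refl , refl)
SameEdge-sym (inj₂ (refl , refl)) = inj₂ (refl , refl)

SameEdge-trans : {e f : A} → SameEdge a b c d → SameEdge c d e f → SameEdge a b e f
SameEdge-trans (inj₁ (refl , refl)) same = same
SameEdge-trans (inj₂ (refl , refl)) (inj₁ (refl , refl)) = inj₂ (refl , refl)
SameEdge-trans (inj₂ (refl , refl)) (inj₂ (refl , refl)) = inj₁ (refl , refl)

SameEdge-cancelˡ : SameEdge c d c e → d ≡ e
SameEdge-cancelˡ (inj₁ (_ , d≡e)) = d≡e
SameEdge-cancelˡ (inj₂ (c≡e , d≡c)) = trans d≡c c≡e

any-⊎? : {P : Fin n ⊎ Fin m → Set} → Decidable P → Dec (∃ P)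
any-⊎? P? with any? (P? ∘ inj₁) | any? (P? ∘ inj₂)
... | yes (a , pa) | _ = yes (inj₁ a , pa)
... | no _ | yes (b , pb) = yes (inj₂ b , pb)
... | no ¬left | no ¬right =
      no λ { (inj₁ a , pa) → ¬left (a , pa) ; (inj₂ b , pb) → ¬right (b , pb) }

injective-into-⊎⇒≤ : {f : Fin j → Fin n ⊎ Fin m} → Injective _≡_ _≡_ f → j ≤ n + m
injective-into-⊎⇒≤ {n = n} {m} inj = injective⇒≤ λ eq →
  inj (trans (sym (splitAt-join n m _)) (trans (cong (splitAt n) eq) (splitAt-join n m _)))

injective-from-⊎⇒≤ : {f : Fin n ⊎ Fin m → Fin j} → Injective _≡_ _≡_ f → n + m ≤ j
injective-from-⊎⇒≤ {n = n} {m} {f = f} inj = injective⇒≤ {f = f ∘ splitAt n} λ {i} {i′} eq →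
  trans (sym (join-splitAt n m i)) (trans (cong (join n m) (inj eq)) (join-splitAt n m i′))

fresh-∷-injective : {f : Fin j → A} → Injective _≡_ _≡_ f → (∀ i → f i ≢ a) →
  Injective _≡_ _≡_ (a ∷ f)
fresh-∷-injective _ _ {zero} {zero} _ = refl
fresh-∷-injective _ fresh {zero} {suc j} eq = contradiction (sym eq) (fresh j)
fresh-∷-injective _ fresh {suc i} {zero} eq = contradiction eq (fresh i)
fresh-∷-injective inj _ {suc i} {suc j} eq = cong suc (inj eq)

injective-off-point⇒≤ : (f : Fin n ⊎ Fin m → Fin k) (z : Fin n ⊎ Fin m) →
  (∀ {u w} → u ≢ z → w ≢ z → f u ≡ f w → u ≡ w) → n + m ≤ suc k
injective-off-point⇒≤ {n = n} {m} {k} f z injective-off = injective-from-⊎⇒≤ {f = g} g-injective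
  where
  g : Fin n ⊎ Fin m → Fin (suc k)
  g u with Sum.≡-dec Fin._≟_ Fin._≟_ u z
  ... | yes _ = zero
  ... | no _ = suc (f u)
  g-injective : Injective _≡_ _≡_ g
  g-injective {u} {w} eq with Sum.≡-dec Fin._≟_ Fin._≟_ u z | Sum.≡-dec Fin._≟_ Fin._≟_ w z
  ... | yes refl | yes refl = refl
  ... | no u≢z | no w≢z = injective-off u≢z w≢z (Fin.suc-injective eq)

countNothing : (Fin n → Maybe A) → ℕ
countNothing {zero} _ = 0
countNothing {suc n} f = maybe′ (λ _ → 0) 1 (f zero) + countNothing (f ∘ suc)

countNothing-cong : {f g : Fin n → Maybe A} → (∀ i → f i ≡ g i) → countNothing f ≡ countNothing g
countNothing-cong {zero} _ = refl
countNothing-cong {suc n} f≗g =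
  cong₂ _+_ (cong (maybe′ _ 1) (f≗g zero)) (countNothing-cong (f≗g ∘ suc))

countNothing-all : {f : Fin n → Maybe A} → (∀ i → f i ≡ nothing) → countNothing f ≡ n
countNothing-all {zero} _ = refl
countNothing-all {suc n} none rewrite none zero = cong suc (countNothing-all (none ∘ suc))

countNothing-update : {f g : Fin n → Maybe A} (p : Fin n) → f p ≡ nothing → g p ≡ just a →
  (∀ i → i ≢ p → g i ≡ f i) → countNothing f ≡ suc (countNothing g)
countNothing-update zero fp gp rest rewrite fp | gp =
  cong suc (countNothing-cong λ i → sym (rest (suc i) λ ()))
countNothing-update {f = f} (suc p) fp gp rest rewrite rest zero (λ ()) =
  trans (cong (maybe′ _ 1 (f zero) +_)
              (countNothing-update p fp gp λ i i≢p → rest (suc i) (i≢p ∘ Fin.suc-injective)))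
        (+-suc _ _)

nothing-exists : (f : Fin n → Maybe A) → countNothing f ≢ 0 → ∃ λ i → f i ≡ nothing
nothing-exists {zero} _ ≢0 = contradiction refl ≢0
nothing-exists {suc n} f ≢0 with f zero in f0
... | nothing = zero , f0
... | just _ = let i , fi = nothing-exists (f ∘ suc) ≢0 in suc i , fi

all-nothing-or-some-just : (f : Fin n → Maybe A) → (∀ i → f i ≡ nothing) ⊎ ∃₂ λ i a → f i ≡ just a
all-nothing-or-some-just {zero} _ = inj₁ λ ()
all-nothing-or-some-just {suc n} f with f zero in f0 | all-nothing-or-some-just (f ∘ suc)
... | just a | _ = inj₂ (zero , a , f0)
... | nothing | inj₂ (i , a , fi) = inj₂ (suc i , a , fi)
... | nothing | inj₁ none = inj₁ λ { zero → f0 ; (suc i) → none i }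

odd⇒≢0 : parity n ≡ 1ℙ → n ≢ 0
odd⇒≢0 {zero} ()
odd⇒≢0 {suc n} _ ()

parity-+-evenʳ : ∀ {n m} → parity m ≡ 0ℙ → parity (n + m) ≡ parity n
parity-+-evenʳ {n} {m} m-even =
  trans (+-homo-+ n m) (trans (cong (parity n ℙ.+_) m-even) (+-identityʳ _))

parity-+-evenˡ : ∀ {n m} → parity n ≡ 0ℙ → parity (n + m) ≡ parity m
parity-+-evenˡ {n} {m} n-even = trans (+-homo-+ n m) (cong (ℙ._+ parity m) n-even)

odd-sum⇒even-summand : ∀ {n m} → parity (n + m) ≡ 1ℙ → parity m ≡ 0ℙ ⊎ parity n ≡ 0ℙ
odd-sum⇒even-summand {n} {m} odd with parity n in n-parity | parity m in m-parity
... | 0ℙ | _ = inj₂ refl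
... | 1ℙ | 0ℙ = inj₁ refl
... | 1ℙ | 1ℙ =
      contradiction (trans (sym odd) (trans (+-homo-+ n m) (cong₂ ℙ._+_ n-parity m-parity))) λ ()

%2≡1⇒odd : ∀ n → n % 2 ≡ 1 → parity n ≡ 1ℙ
%2≡1⇒odd 0 ()
%2≡1⇒odd 1 _ = refl
%2≡1⇒odd (suc (suc n)) = %2≡1⇒odd n

%2≡0⇒even : ∀ n → n % 2 ≡ 0 → parity n ≡ 0ℙ
%2≡0⇒even 0 _ = refl
%2≡0⇒even 1 ()
%2≡0⇒even (suc (suc n)) = %2≡0⇒even n

module Colorings (G : Graph) {k : ℕ} where
  open Graph G

  private
    variable
      s : PartialColoring G k
      u v w x y : V

  Colored : PartialColoring G k → V → Set
  Colored s u = ∃ λ a → s u ≡ just a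

  ColoredEdge : PartialColoring G k → Set
  ColoredEdge s = ∃₂ λ u w → Adj u w × Colored s u × Colored s w

  MonochromaticEdge : PartialColoring G k → Set
  MonochromaticEdge s = ∃₂ λ u w → Adj u w × ∃ λ a → s u ≡ just a × s w ≡ just a

  AtMostOneColored : PartialColoring G k → Set
  AtMostOneColored s = ∀ {u w a b} → s u ≡ just a → s w ≡ just b → u ≡ w

  LegalMove : PartialColoring G k → Set
  LegalMove s = ∃₂ λ v c → s v ≡ nothing × PartialInjective G k (update G k s v c)

  DistinctNeighborColors : PartialColoring G k → V → Set
  DistinctNeighborColors s v =
    ∀ {w w′ d} → Adj v w → Adj v w′ → s w ≡ just d → s w′ ≡ just d → w ≡ w′

  NewEdgeColors : PartialColoring G k → V → Fin k → Set
  NewEdgeColors s v c = ∀ {w x y d a b} → Adj v w → s w ≡ just d →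
    Adj x y → s x ≡ just a → s y ≡ just b → ¬ SameEdge c d a b

  update-≡ : ∀ s v (c : Fin k) → update G k s v c v ≡ just c
  update-≡ s v c with v ≟V v
  ... | yes _ = refl
  ... | no v≢v = contradiction refl v≢v

  update-≢ : ∀ s (c : Fin k) → w ≢ v → update G k s v c w ≡ s w
  update-≢ {w} {v} s c w≢v with w ≟V v
  ... | yes w≡v = contradiction w≡v w≢v
  ... | no _ = refl

  update-just : ∀ s (c : Fin k) → update G k s v c w ≡ just a → (w ≡ v × c ≡ a) ⊎ s w ≡ just a
  update-just {v} {w} s c sw with w ≟V v
  ... | yes w≡v = inj₁ (w≡v , just-injective sw)
  ... | no _ = inj₂ sw

  update-colored : {c : Fin k} → s v ≡ nothing → Colored s w → Colored (update G k s v c) w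
  update-colored {v = v} {w} sv (a , sw) with w ≟V v
  ... | yes refl = contradiction (trans (sym sv) sw) λ ()
  ... | no _ = a , sw

  update-empty-single : {c : Fin k} → AtMostOneColored (update G k (emptyColoring G k) v c)
  update-empty-single {v = v} {c} su sw = trans (only su) (sym (only sw))
    where
    only : update G k (emptyColoring G k) v c u ≡ just a → u ≡ v
    only su with update-just (emptyColoring G k) c su
    ... | inj₁ (u≡v , _) = u≡v
    ... | inj₂ ()

  injective-on-neighborhood : PartialInjective G k s → Adj u w → Adj v w →
    s u ≡ just a → s v ≡ just a → s w ≡ just b → u ≡ v
  injective-on-neighborhood pi uw vw su sv sw
    with pi _ _ _ _ _ _ _ _ uw vw su sw sv sw (inj₁ (refl , refl))
  ... | inj₁ (u≡v , _) = u≡v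
  ... | inj₂ (refl , refl) = contradiction uw irrefl

  data UpdatedEdge (s : PartialColoring G k) (v : V) (c : Fin k) (u w : V) (a b : Fin k) : Set where
    old : s u ≡ just a → s w ≡ just b → UpdatedEdge s v c u w a b
    new : ∀ {t d} → Adj v t → s t ≡ just d →
          SameEdge u w v t → SameEdge a b c d → UpdatedEdge s v c u w a b

  updated-edge : ∀ {c : Fin k} → Adj u w →
    update G k s v c u ≡ just a → update G k s v c w ≡ just b → UpdatedEdge s v c u w a b
  updated-edge {s = s} {c = c} uw su sw with update-just s c su | update-just s c sw
  ... | inj₁ (refl , _) | inj₁ (refl , _) = contradiction uw irrefl
  ... | inj₁ (refl , refl) | inj₂ sw′ = new uw sw′ (inj₁ (refl , refl)) (inj₁ (refl , refl))
  ... | inj₂ su′ | inj₁ (refl , refl) = new (symm uw) su′ (inj₂ (refl , refl)) (inj₂ (refl , refl))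
  ... | inj₂ su′ | inj₂ sw′ = old su′ sw′

  update-injective : ∀ {c} → PartialInjective G k s → s v ≡ nothing →
    DistinctNeighborColors s v → NewEdgeColors s v c → PartialInjective G k (update G k s v c)
  update-injective pi sv distinct fresh u w x y a b a′ b′ uw xy su sw sx sy same
    with updated-edge uw su sw | updated-edge xy sx sy
  ... | old su′ sw′ | old sx′ sy′ = pi u w x y a b a′ b′ uw xy su′ sw′ sx′ sy′ same
  ... | old su′ sw′ | new vt st _ new₂ =
        ⊥-elim (fresh vt st uw su′ sw′ (SameEdge-sym (SameEdge-trans same new₂)))
  ... | new vt st _ new₁ | old sx′ sy′ =
        ⊥-elim (fresh vt st xy sx′ sy′ (SameEdge-trans (SameEdge-sym new₁) same))
  ... | new vt st e₁ new₁ | new vt′ st′ e₂ new₂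
        with distinct vt vt′ st (trans st′ (cong just (sym (SameEdge-cancelˡ
               (SameEdge-trans (SameEdge-sym new₁) (SameEdge-trans same new₂))))))
  ...   | refl = SameEdge-trans e₁ (SameEdge-sym e₂)

  update-injective-isolated : ∀ {c} → PartialInjective G k s → s v ≡ nothing →
    (∀ {w} → Adj v w → s w ≡ nothing) → PartialInjective G k (update G k s v c)
  update-injective-isolated {s = s} {v = v} pi sv isolated =
    update-injective pi sv (λ vw _ sw _ → ⊥-elim (uncolored vw sw)) (λ vw sw _ _ _ _ → uncolored vw sw)
    where
    uncolored : Adj v w → s w ≡ just a → ⊥
    uncolored vw sw = contradiction (trans (sym (isolated vw)) sw) λ ()

  update-injective-single : ∀ {c} → AtMostOneColored s → s v ≡ nothing →
    PartialInjective G k (update G k s v c)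
  update-injective-single {s = s} one sv =
    update-injective single-injective sv (λ _ _ sw sw′ → one sw sw′) λ _ _ xy sx sy _ → loop xy sx sy
    where
    loop : Adj x y → s x ≡ just a → s y ≡ just b → ⊥
    loop {x} xy sx sy = irrefl (subst (Adj x) (sym (one sx sy)) xy)
    single-injective : PartialInjective G k s
    single-injective _ _ _ _ _ _ _ _ uw _ su sw _ _ _ = ⊥-elim (loop uw su sw)

module ParityStrategy (G : Graph) (k : ℕ)
  (Inv : PartialColoring G k → Set)
  (rank : PartialColoring G k → ℕ)
  (rank-update : ∀ s v c → s v ≡ nothing → rank s ≡ suc (rank (update G k s v c)))
  (Inv-update : ∀ {s v c} → Inv s → s v ≡ nothing →
    PartialInjective G k (update G k s v c) → Inv (update G k s v c))
  (odd-move : ∀ {s} → Inv s → parity (rank s) ≡ 1ℙ → Colorings.LegalMove G s)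
  where

  private
    variable
      s : PartialColoring G k
      v : Graph.V G
      p : Parity

  parity-update : ∀ {c} → s v ≡ nothing → parity (rank s) ≡ p →
    parity (rank (update G k s v c)) ≡ p ⁻¹
  parity-update {s = s} {v = v} {c = c} sv eq =
    trans (sym (suc-homo-⁻¹ (rank (update G k s v c))))
          (cong _⁻¹ (trans (cong parity (sym (rank-update s v c sv))) eq))

  private
    rank-step : ∀ {r c} → rank s ≡ suc r → s v ≡ nothing → rank (update G k s v c) ≡ r
    rank-step {c = c} eq sv = suc-injective (trans (sym (rank-update _ _ c sv)) eq)

    winning : ∀ r → rank s ≡ r → Inv s → parity (rank s) ≡ 1ℙ → Win G k s
    losing : ∀ r → rank s ≡ r → Inv s → parity (rank s) ≡ 0ℙ → Lose G k s
    winning zero eq _ odd = contradiction (trans (cong parity (sym eq)) odd) λ ()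
    winning (suc r) eq inv odd =
      let v , c , sv , legal = odd-move inv odd in
      win v c sv legal (losing r (rank-step eq sv) (Inv-update inv sv legal) (parity-update sv odd))
    losing zero eq _ _ = lose λ v c sv _ → contradiction (trans (sym eq) (rank-update _ _ c sv)) 0≢1+n
    losing (suc r) eq inv even = lose λ v c sv legal →
      winning r (rank-step eq sv) (Inv-update inv sv legal) (parity-update sv even)

  even⇒lose : Inv s → parity (rank s) ≡ 0ℙ → Lose G k s
  even⇒lose = losing _ refl

open module KColorings {n m k : ℕ} = Colorings (K n m) {k}

KAdj? : (u w : Fin n ⊎ Fin m) → Dec (KAdj u w)
KAdj? (inj₁ _) (inj₁ _) = no λ ()
KAdj? (inj₁ _) (inj₂ _) = yes tt
KAdj? (inj₂ _) (inj₁ _) = yes tt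
KAdj? (inj₂ _) (inj₂ _) = no λ ()

nonadjacent⇒same-neighbors : {u v w : Fin n ⊎ Fin m} → ¬ KAdj u v → KAdj v w → KAdj u w
nonadjacent⇒same-neighbors {u = inj₁ _} {inj₁ _} {inj₂ _} _ _ = tt
nonadjacent⇒same-neighbors {u = inj₂ _} {inj₂ _} {inj₁ _} _ _ = tt
nonadjacent⇒same-neighbors {u = inj₁ _} {inj₂ _} ¬uv _ = contradiction tt ¬uv
nonadjacent⇒same-neighbors {u = inj₂ _} {inj₁ _} ¬uv _ = contradiction tt ¬uv
nonadjacent⇒same-neighbors {u = inj₁ _} {inj₁ _} {inj₁ _} _ ()
nonadjacent⇒same-neighbors {u = inj₂ _} {inj₂ _} {inj₂ _} _ ()

triangle-free : {u v w : Fin n ⊎ Fin m} → KAdj u v → KAdj v w → ¬ KAdj u w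
triangle-free {u = inj₁ _} {inj₂ _} {inj₁ _} _ _ ()
triangle-free {u = inj₂ _} {inj₁ _} {inj₂ _} _ _ ()
triangle-free {u = inj₁ _} {inj₁ _} ()
triangle-free {u = inj₂ _} {inj₂ _} ()
triangle-free {u = inj₁ _} {inj₂ _} {inj₂ _} _ ()
triangle-free {u = inj₂ _} {inj₁ _} {inj₁ _} _ ()

opposite : Fin (suc n) ⊎ Fin (suc m) → Fin (suc n) ⊎ Fin (suc m)
opposite (inj₁ _) = inj₂ zero
opposite (inj₂ _) = inj₁ zero

adjacent-opposite : (v : Fin (suc n) ⊎ Fin (suc m)) → KAdj v (opposite v)
adjacent-opposite (inj₁ _) = tt
adjacent-opposite (inj₂ _) = tt

module _ {n m k : ℕ} where
  private
    variable
      s : PartialColoring (K n m) k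
      t u v w x y z : Fin n ⊎ Fin m

    _≟ᵥ_ : (u w : Fin n ⊎ Fin m) → Dec (u ≡ w)
    _≟ᵥ_ = Sum.≡-dec Fin._≟_ Fin._≟_

    _≟ₘ_ : (a b : Maybe (Fin k)) → Dec (a ≡ b)
    _≟ₘ_ = Maybe.≡-dec Fin._≟_

  every-color-used⇒2+k≤n+m : (s : PartialColoring (K n m) k) → s v ≡ nothing → v ≢ z →
    (∀ c → ∃ λ u → u ≢ z × s u ≡ just c) → 2 + k ≤ n + m
  every-color-used⇒2+k≤n+m {v = v} {z} s sv v≢z used =
    injective-into-⊎⇒≤ (fresh-∷-injective (fresh-∷-injective pick-injective pick≢v) ≢z)
    where
    pick : Fin k → Fin n ⊎ Fin m
    pick c = proj₁ (used c)
    colored-by : ∀ c → s (pick c) ≡ just c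
    colored-by c = proj₂ (proj₂ (used c))
    pick-injective : Injective _≡_ _≡_ pick
    pick-injective {c} {c′} eq =
      just-injective (trans (sym (colored-by c)) (trans (cong s eq) (colored-by c′)))
    pick≢v : ∀ c → pick c ≢ v
    pick≢v c refl = contradiction (trans (sym sv) (colored-by c)) λ ()
    ≢z : ∀ i → (v ∷ pick) i ≢ z
    ≢z zero = v≢z
    ≢z (suc c) = proj₁ (proj₂ (used c))

  free-color : n + m ≤ suc k → (s : PartialColoring (K n m) k) → s v ≡ nothing → v ≢ z →
    {S : Fin n ⊎ Fin m → Set} → Decidable S → ¬ S z → ∃ λ c → ∀ u → S u → s u ≢ just c
  free-color {z = z} bound s sv v≢z {S} S? ¬Sz
    with any? (λ c → ¬? (any-⊎? λ u → S? u ×-dec (s u ≟ₘ just c)))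
  ... | yes (c , unused) = c , λ u Su su → unused (u , Su , su)
  ... | no ¬free =
        contradiction (≤-trans (every-color-used⇒2+k≤n+m s sv v≢z used) bound) (<-irrefl refl)
    where
    used : ∀ c → ∃ λ u → u ≢ z × s u ≡ just c
    used c with any-⊎? (λ u → S? u ×-dec (s u ≟ₘ just c))
    ... | yes (u , Su , su) = u , (λ { refl → ¬Sz Su }) , su
    ... | no unused = contradiction (c , unused) ¬free

  -- A color unused off w is unused everywhere, since w's color also sits on its neighbor y.
  unused-color : n + m ≤ suc k → s v ≡ nothing → MonochromaticEdge s → ∃ λ c → ∀ {x} → s x ≢ just c
  unused-color {s = s} {v = v} bound sv (y , w , yw , d , sy , sw) =
    let c , free = free-color bound s sv v≢w (λ u → ¬? (u ≟ᵥ w)) (_$ refl) in c , unused free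
    where
    v≢w : v ≢ w
    v≢w refl = contradiction (trans (sym sv) sw) λ ()
    unused : ∀ {c} → (∀ u → u ≢ w → s u ≢ just c) → ∀ {x} → s x ≢ just c
    unused free {x} sx with x ≟ᵥ w
    ... | no x≢w = free x x≢w sx
    ... | yes refl =
          free y (λ { refl → KAdj-irr yw }) (trans sy (cong just (just-injective (trans (sym sw) sx))))

  near-color : n + m ≤ suc k → s v ≡ nothing → KAdj v t →
    ∃ λ c → ∀ {x} → s x ≡ just c → KAdj v x
  near-color {s = s} {v = v} {t = t} bound sv vt =
    let c , free = free-color bound s sv v≢t (λ u → ¬? (KAdj? v u)) (_$ vt) in
    c , λ {x} sx → decidable-stable (KAdj? v x) λ ¬vx → free x ¬vx sx
    where
    v≢t : v ≢ t
    v≢t refl = KAdj-irr vt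

  monochromatic? : (s : PartialColoring (K n m) k) → Dec (MonochromaticEdge s)
  monochromatic? s = any-⊎? λ y → any-⊎? λ w →
    KAdj? y w ×-dec any? λ d → (s y ≟ₘ just d) ×-dec (s w ≟ₘ just d)

  repeated-color⇒monochromatic : ∀ {c} →
    (∀ {x} → s x ≡ just c → KAdj v x × ¬ MonochromaticEdge s) →
    KAdj v w → s w ≡ just d → KAdj x y → s x ≡ just c → s y ≡ just d → ⊥
  repeated-color⇒monochromatic only-near vw sw xy sx sy =
    let vx , no-mono = only-near sx in
    no-mono (_ , _ , nonadjacent⇒same-neighbors (triangle-free vx xy ∘ KAdj-sym) vw , _ , sy , sw)

  new-edge-colors : ∀ {c} → (∀ {x} → s x ≡ just c → KAdj v x × ¬ MonochromaticEdge s) →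
    NewEdgeColors s v c
  new-edge-colors only-near vw sw xy sx sy (inj₁ (refl , refl)) =
    repeated-color⇒monochromatic only-near vw sw xy sx sy
  new-edge-colors only-near vw sw xy sx sy (inj₂ (refl , refl)) =
    repeated-color⇒monochromatic only-near vw sw (KAdj-sym xy) sy sx

  fresh-color : n + m ≤ suc k → s v ≡ nothing → KAdj v t → ∃ (NewEdgeColors s v)
  fresh-color {s = s} bound sv vt with monochromatic? s
  ... | yes mono =
        map₂ (λ unused → new-edge-colors λ sx → ⊥-elim (unused sx)) (unused-color bound sv mono)
  ... | no no-mono =
        map₂ (λ near → new-edge-colors λ sx → near sx , no-mono) (near-color bound sv vt)

  distinct-neighbor-colors : PartialInjective (K n m) k s → s z ≡ just e → ¬ KAdj v z →
    DistinctNeighborColors s v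
  distinct-neighbor-colors {z = z} {v = v} pi sz ¬vz vw vw′ sw sw′ =
    injective-on-neighborhood pi (KAdj-sym (zw vw)) (KAdj-sym (zw vw′)) sw sw′ sz
    where
    zw : ∀ {w} → KAdj v w → KAdj z w
    zw = nonadjacent⇒same-neighbors (¬vz ∘ KAdj-sym)

  extend-across : n + m ≤ suc k → PartialInjective (K n m) k s → s v ≡ nothing →
    s z ≡ just e → ¬ KAdj v z → KAdj v t →
    ∃ λ c → PartialInjective (K n m) k (update (K n m) k s v c)
  extend-across bound pi sv sz ¬vz vt =
    let c , fresh = fresh-color bound sv vt in
    c , update-injective pi sv (distinct-neighbor-colors pi sz ¬vz) fresh

  extendable : n + m ≤ suc k → PartialInjective (K n m) k s → s v ≡ nothing → ColoredEdge s →
    ∃ λ c → PartialInjective (K n m) k (update (K n m) k s v c)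
  extendable {v = v} bound pi sv (u , w , uw , (_ , su) , (_ , sw)) with KAdj? v u
  ... | yes vu = extend-across bound pi sv sw (triangle-free vu uw) vu
  ... | no ¬vu = extend-across bound pi sv su ¬vu (nonadjacent⇒same-neighbors ¬vu uw)

  uncolored : PartialColoring (K n m) k → ℕ
  uncolored s = countNothing (s ∘ inj₁) + countNothing (s ∘ inj₂)

  uncolored-update : ∀ s v c → s v ≡ nothing →
    uncolored s ≡ suc (uncolored (update (K n m) k s v c))
  uncolored-update s (inj₁ p) c sv =
    cong₂ _+_
      (countNothing-update {f = s ∘ inj₁} {g = update (K n m) k s (inj₁ p) c ∘ inj₁} p sv
        (update-≡ s (inj₁ p) c) λ _ a≢p → update-≢ s c (a≢p ∘ inj₁-injective))
      (countNothing-cong λ b → sym (update-≢ {w = inj₂ b} {v = inj₁ p} s c λ ()))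
  uncolored-update s (inj₂ q) c sv =
    trans (cong₂ _+_
            (countNothing-cong λ a → sym (update-≢ {w = inj₁ a} {v = inj₂ q} s c λ ()))
            (countNothing-update {f = s ∘ inj₂} {g = update (K n m) k s (inj₂ q) c ∘ inj₂} q sv
              (update-≡ s (inj₂ q) c) λ _ b≢q → update-≢ s c (b≢q ∘ inj₂-injective)))
          (+-suc _ _)

  uncolored-empty : uncolored (emptyColoring (K n m) k) ≡ n + m
  uncolored-empty = cong₂ _+_
    (countNothing-all {f = emptyColoring (K n m) k ∘ inj₁} λ _ → refl)
    (countNothing-all {f = emptyColoring (K n m) k ∘ inj₂} λ _ → refl)

  uncolored-vertex : uncolored s ≢ 0 → ∃ λ v → s v ≡ nothing
  uncolored-vertex {s = s} ≢0 with countNothing (s ∘ inj₁) ≟ 0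
  ... | no left≢0 = let a , sa = nothing-exists (s ∘ inj₁) left≢0 in inj₁ a , sa
  ... | yes left≡0 =
        let b , sb = nothing-exists (s ∘ inj₂) λ right≡0 → ≢0 (cong₂ _+_ left≡0 right≡0) in
        inj₂ b , sb

  -- The invariant of both strategies: in such a position the player to move is never stuck
  -- while an odd number of vertices is uncolored.
  data Anchored (s : PartialColoring (K n m) k) : Set where
    edge : ColoredEdge s → Anchored s
    left : ∀ {a} → Colored s (inj₁ a) → parity m ≡ 0ℙ → Anchored s
    right : ∀ {b} → Colored s (inj₂ b) → parity n ≡ 0ℙ → Anchored s

  Safe : PartialColoring (K n m) k → Set
  Safe s = PartialInjective (K n m) k s × Anchored s

  safe-update : ∀ {s v c} → Safe s → s v ≡ nothing →
    PartialInjective (K n m) k (update (K n m) k s v c) → Safe (update (K n m) k s v c)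
  safe-update {s} {v} {c} (_ , anchored) sv legal = legal , update-anchored anchored
    where
    keep : ∀ {w} → Colored s w → Colored (update (K n m) k s v c) w
    keep {w} = update-colored {s = s} {v = v} {w = w} sv
    update-anchored : Anchored s → Anchored (update (K n m) k s v c)
    update-anchored (edge (u , w , uw , cu , cw)) = edge (u , w , uw , keep cu , keep cw)
    update-anchored (left ca m-even) = left (keep ca) m-even
    update-anchored (right cb n-even) = right (keep cb) n-even

  edge-move : n + m ≤ suc k → PartialInjective (K n m) k s → ColoredEdge s →
    parity (uncolored s) ≡ 1ℙ → LegalMove s
  edge-move {s = s} bound pi colored-edge odd =
    let v , sv = uncolored-vertex {s = s} (odd⇒≢0 odd)
        c , legal = extendable bound pi sv colored-edge
    in v , c , sv , legal

  left-only-move : PartialInjective (K n m) k s → (∀ b → s (inj₂ b) ≡ nothing) →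
    parity m ≡ 0ℙ → parity (uncolored s) ≡ 1ℙ → Fin k → LegalMove s
  left-only-move {s = s} pi right-uncolored m-even odd c =
    let a , sa = nothing-exists (s ∘ inj₁) (odd⇒≢0 left-odd) in
    inj₁ a , c , sa , update-injective-isolated pi sa λ { {inj₂ b} _ → right-uncolored b }
    where
    open ≡-Reasoning
    left-odd : parity (countNothing (s ∘ inj₁)) ≡ 1ℙ
    left-odd = begin
      parity (countNothing (s ∘ inj₁))
        ≡⟨ parity-+-evenʳ {countNothing (s ∘ inj₁)} m-even ⟨
      parity (countNothing (s ∘ inj₁) + m)
        ≡⟨ cong (parity ∘ (countNothing (s ∘ inj₁) +_)) (countNothing-all right-uncolored) ⟨
      parity (uncolored s)
        ≡⟨ odd ⟩
      1ℙ ∎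

  right-only-move : PartialInjective (K n m) k s → (∀ a → s (inj₁ a) ≡ nothing) →
    parity n ≡ 0ℙ → parity (uncolored s) ≡ 1ℙ → Fin k → LegalMove s
  right-only-move {s = s} pi left-uncolored n-even odd c =
    let b , sb = nothing-exists (s ∘ inj₂) (odd⇒≢0 right-odd) in
    inj₂ b , c , sb , update-injective-isolated pi sb λ { {inj₁ a} _ → left-uncolored a }
    where
    open ≡-Reasoning
    right-odd : parity (countNothing (s ∘ inj₂)) ≡ 1ℙ
    right-odd = begin
      parity (countNothing (s ∘ inj₂))
        ≡⟨ parity-+-evenˡ {n} {countNothing (s ∘ inj₂)} n-even ⟨
      parity (n + countNothing (s ∘ inj₂))
        ≡⟨ cong (parity ∘ (_+ countNothing (s ∘ inj₂))) (countNothing-all left-uncolored) ⟨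
      parity (uncolored s)
        ≡⟨ odd ⟩
      1ℙ ∎

  odd-move : n + m ≤ suc k → Safe s → parity (uncolored s) ≡ 1ℙ → LegalMove s
  odd-move bound (pi , edge colored-edge) odd = edge-move bound pi colored-edge odd
  odd-move {s = s} bound (pi , left {a} (c , sa) m-even) odd
    with all-nothing-or-some-just (s ∘ inj₂)
  ... | inj₁ right-uncolored = left-only-move pi right-uncolored m-even odd c
  ... | inj₂ (b , c′ , sb) = edge-move bound pi (inj₁ a , inj₂ b , tt , (c , sa) , (c′ , sb)) odd
  odd-move {s = s} bound (pi , right {b} (c , sb) n-even) odd
    with all-nothing-or-some-just (s ∘ inj₁)
  ... | inj₁ left-uncolored = right-only-move pi left-uncolored n-even odd c
  ... | inj₂ (a , c′ , sa) = edge-move bound pi (inj₁ a , inj₂ b , tt , (c′ , sa) , (c , sb)) odd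

  module Strategy (bound : n + m ≤ suc k) =
    ParityStrategy (K n m) k Safe uncolored uncolored-update safe-update (odd-move bound)

-- Each part is colored injectively and a color shared by the two parts is shared only once,
-- so the coloring becomes injective after removing the right endpoint b₀ of that color.
edge-distinguishing-bound : (c : Fin (suc n) ⊎ Fin (suc m) → Fin k) →
  EdgeDistinguishing (K (suc n) (suc m)) k c → suc n + suc m ≤ suc k
edge-distinguishing-bound {m = m} c ed = injective-off-point⇒≤ c (inj₂ b₀) injective-off
  where
  cross : ∀ {a b a′ b′} → SameEdge (c (inj₁ a)) (c (inj₂ b)) (c (inj₁ a′)) (c (inj₂ b′)) →
    a ≡ a′ × b ≡ b′
  cross {a} {b} {a′} {b′} same with ed (inj₁ a) (inj₂ b) (inj₁ a′) (inj₂ b′) tt tt same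
  ... | inj₁ (refl , refl) = refl , refl
  shared : ∃ λ b₀ → ∀ {a b} → c (inj₁ a) ≡ c (inj₂ b) → b ≡ b₀
  shared with any? (λ a → any? λ b → c (inj₁ a) Fin.≟ c (inj₂ b))
  ... | yes (a₀ , b₀ , e₀) = b₀ , λ e → sym (proj₂ (cross (inj₂ (e , sym e₀))))
  ... | no none = zero , λ {a} {b} e → contradiction (a , b , e) none
  b₀ : Fin (suc m)
  b₀ = proj₁ shared
  injective-off : ∀ {u w} → u ≢ inj₂ b₀ → w ≢ inj₂ b₀ → c u ≡ c w → u ≡ w
  injective-off {inj₁ a} {inj₁ a′} _ _ e =
    cong inj₁ (proj₁ (cross {b = zero} {b′ = zero} (inj₁ (e , refl))))
  injective-off {inj₂ b} {inj₂ b′} _ _ e =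
    cong inj₂ (proj₂ (cross {a = zero} {a′ = zero} (inj₁ (refl , e))))
  injective-off {inj₁ a} {inj₂ b} _ w≢b₀ e = contradiction (cong inj₂ (proj₂ shared e)) w≢b₀
  injective-off {inj₂ b} {inj₁ a} u≢b₀ _ e = contradiction (cong inj₂ (proj₂ shared (sym e))) u≢b₀

module _ {n m k : ℕ} (bound : suc n + suc m ≤ suc k) where
  open Strategy {suc n} {suc m} {k} bound

  private
    G : Graph
    G = K (suc n) (suc m)

    empty : PartialColoring G k
    empty = emptyColoring G k

    empty-parity : parity (uncolored empty) ≡ parity (suc n + suc m)
    empty-parity = cong parity (uncolored-empty {suc n} {suc m} {k})

  opening-wins : parity (suc n + suc m) ≡ 1ℙ → ∀ v c → Anchored (update G k empty v c) →
    Player1Wins G k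
  opening-wins odd v c anchored =
    win v c refl legal
      (even⇒lose (legal , anchored) (parity-update {s = empty} {v = v} {c = c} refl (trans empty-parity odd)))
    where
    legal : PartialInjective G k (update G k empty v c)
    legal = update-injective-single {s = empty} (λ ()) refl

  player1-wins : Fin k → parity (suc n + suc m) ≡ 1ℙ → Player1Wins G k
  player1-wins c odd with odd-sum⇒even-summand {suc n} odd
  ... | inj₁ m-even =
        opening-wins odd (inj₁ zero) c (left {a = zero} (c , update-≡ empty (inj₁ zero) c) m-even)
  ... | inj₂ n-even =
        opening-wins odd (inj₂ zero) c (right {b = zero} (c , update-≡ empty (inj₂ zero) c) n-even)

  player2-wins : parity (suc n + suc m) ≡ 0ℙ → Player2Wins G k
  player2-wins even = lose λ v c _ _ → copy-across v c
    where
    copy-across : ∀ v c → Win G k (update G k empty v c)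
    copy-across v c =
      win w c w-uncolored legal (even⇒lose (legal , edge colored-edge)
        (parity-update {s = s₁} {v = w} {c = c} w-uncolored
          (parity-update {s = empty} {v = v} {c = c} refl (trans empty-parity even))))
      where
      s₁ : PartialColoring G k
      s₁ = update G k empty v c
      w : Graph.V G
      w = opposite v
      w-uncolored : s₁ w ≡ nothing
      w-uncolored = update-≢ empty c λ w≡v → KAdj-irr (subst (KAdj v) w≡v (adjacent-opposite v))
      legal : PartialInjective G k (update G k s₁ w c)
      legal = update-injective-single (update-empty-single {v = v} {c = c}) w-uncolored
      colored-edge : ColoredEdge (update G k s₁ w c)
      colored-edge = v , w , adjacent-opposite v ,
        update-colored {s = s₁} {v = w} {w = v} w-uncolored (c , update-≡ empty v c) ,
        (c , update-≡ s₁ w c)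

theorem3p3 : (n m : ℕ) → 1 ≤ n → 1 ≤ m → (k : ℕ) → IsLambda (K n m) k →
    ((n + m) % 2 ≡ 1 → Player1Wins (K n m) k) ×
    ((n + m) % 2 ≡ 0 → Player2Wins (K n m) k)
theorem3p3 (suc n) (suc m) (s≤s z≤n) (s≤s z≤n) k ((c , ed) , _) =
  (λ odd → player1-wins bound (c (inj₁ zero)) (%2≡1⇒odd (suc n + suc m) odd)) ,
  (λ even → player2-wins bound (%2≡0⇒even (suc n + suc m) even))
  where
  bound : suc n + suc m ≤ suc k
  bound = edge-distinguishing-bound c ed
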